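{- Let $L$ be a (positive definite, integral) $\mathbb{Z}$-lattice which is primitively almost universal, and suppose that the rank of the unimodular component of a Jordan decomposition of $L_2=L\otimes\mathbb{Z}_2$ is at most $2$. Then $\lambda_2(L)$ is also primitively almost universal. In particular, if $L$ is primitively universal, then so is $\lambda_2(L)$.
   Context: A $\mathbb{Z}$-lattice $L$ is a free $\mathbb{Z}$-module of finite rank with a symmetric bilinear form $B$ taking values in $\mathbb{Z}$ whose Gram matrix is positive definite; $Q(\mathbf{x})=B(\mathbf{x},\mathbf{x})$. A vector of $L$ is primitive if it belongs to some basis of $L$; $L$ primitively represents a positive integer $n$ if $n=Q(\mathbf{x})$ for some primitive $\mathbf{x}\in L$. $L$ is primitively universal if it primitively represents every positive integer, and primitively almost universal if it primitively represents all but finitely many positive integers. $\Lambda_2(L)=\{\mathbf{x}\in L: Q(\mathbf{x})\equiv 0 \pmod 2\}$, which is a sublattice of $L$, and $\lambda_2(L)$ denotes the primitive lattice (scale ideal equal to $\mathbb{Z}$) obtained from $\Lambda_2(L)$ by scaling its quadratic form by a suitable rational constant. -}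

module Defs where

open import Data.Nat as ℕ using (ℕ; zero; suc)
open import Data.Nat.Divisibility as ℕD using ()
open import Data.Integer as ℤ using (ℤ; +_)
open import Data.Integer.Divisibility as ℤD using ()
open import Data.Rational as ℚ using (ℚ; 0ℚ; 1ℚ; _/_)
open import Data.Fin using (Fin; zero; suc; toℕ; inject≤)
open import Data.Product using (Σ; _×_; ∃; ∃-syntax)
open import Data.Unit using (⊤)
open import Relation.Binary.PropositionalEquality using (_≡_)
open import Relation.Nullary using (¬_)

sumℤ : ∀ {n} → (Fin n → ℤ) → ℤ
sumℤ {zero}  f = + 0
sumℤ {suc n} f = f zero ℤ.+ sumℤ (λ i → f (suc i))

sumℚ : ∀ {n} → (Fin n → ℚ) → ℚ
sumℚ {zero}  f = 0ℚ
sumℚ {suc n} f = f zero ℚ.+ sumℚ (λ i → f (suc i))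

-- Z-lattices: L = ℤ^n with Gram matrix G

Vecℤ : ℕ → Set
Vecℤ n = Fin n → ℤ

Gram : ℕ → Set
Gram n = Fin n → Fin n → ℤ

B : ∀ {n} → Gram n → Vecℤ n → Vecℤ n → ℤ
B G x y = sumℤ (λ i → sumℤ (λ j → x i ℤ.* G i j ℤ.* y j))

Q : ∀ {n} → Gram n → Vecℤ n → ℤ
Q G x = B G x x

Symmetric : ∀ {n} → Gram n → Set
Symmetric G = ∀ i j → G i j ≡ G j i

PositiveDefinite : ∀ {n} → Gram n → Set
PositiveDefinite {n} G = ∀ (x : Vecℤ n) → ¬ (∀ i → x i ≡ + 0) → + 0 ℤ.< Q G x

IsZLattice : ∀ {n} → Gram n → Set
IsZLattice G = Symmetric G × PositiveDefinite G

lincomb : ∀ {n k} → (Fin k → Vecℤ n) → (Fin k → ℤ) → Vecℤ n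
lincomb v c i = sumℤ (λ a → c a ℤ.* v a i)

IsBasis : ∀ {n} → (Vecℤ n → Set) → (k : ℕ) → (Fin k → Vecℤ n) → Set
IsBasis {n} M k v =
  (∀ a → M (v a)) ×
  (∀ (x : Vecℤ n) → M x → ∃[ c ] (∀ i → x i ≡ lincomb v c i)) ×
  (∀ (c : Fin k → ℤ) → (∀ i → lincomb v c i ≡ + 0) → ∀ a → c a ≡ + 0)

PrimitiveIn : ∀ {n} → (Vecℤ n → Set) → Vecℤ n → Set
PrimitiveIn {n} M x =
  Σ ℕ λ k → Σ (Fin k → Vecℤ n) λ v → IsBasis M k v × ∃[ a ] (∀ i → v a i ≡ x i)

Whole : ∀ {n} → Vecℤ n → Set
Whole _ = ⊤

Λ₂ : ∀ {n} → Gram n → Vecℤ n → Set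
Λ₂ G x = (+ 2) ℤD.∣ Q G x

-- s is the (positive generator of the) scale ideal of Λ₂(L),
-- i.e. the ideal generated by B(x,y) for x,y ∈ Λ₂(L)
IsScaleΛ₂ : ∀ {n} → Gram n → ℕ → Set
IsScaleΛ₂ {n} G s =
  (0 ℕ.< s) ×
  (∀ (x y : Vecℤ n) → Λ₂ G x → Λ₂ G y → (+ s) ℤD.∣ B G x y) ×
  (∀ (d : ℤ) → (∀ (x y : Vecℤ n) → Λ₂ G x → Λ₂ G y → d ℤD.∣ B G x y) → d ℤD.∣ (+ s))

LPrimRep : ∀ {n} → Gram n → ℕ → Set
LPrimRep {n} G m = Σ (Vecℤ n) λ x → PrimitiveIn Whole x × Q G x ≡ + m

-- λ₂(L) = Λ₂(L) with form scaled by 1/s (s = scale of Λ₂(L))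
-- primitively represents m
λ₂PrimRep : ∀ {n} → Gram n → ℕ → Set
λ₂PrimRep {n} G m =
  Σ ℕ λ s → IsScaleΛ₂ G s ×
    Σ (Vecℤ n) λ x → PrimitiveIn (Λ₂ G) x × Q G x ≡ + (s ℕ.* m)

PrimUniversal : (ℕ → Set) → Set
PrimUniversal R = ∀ m → 1 ℕ.≤ m → R m

PrimAlmostUniversal : (ℕ → Set) → Set
PrimAlmostUniversal R = ∃[ N ] (∀ m → N ℕ.< m → R m)

-- Jordan decomposition of L ⊗ ℤ₂, computed over ℤ₍₂₎ = ℤ localized at 2

MatQ : ℕ → Set
MatQ n = Fin n → Fin n → ℚ

Inℤ₍₂₎ : ℚ → Set
Inℤ₍₂₎ q = ¬ (2 ℕD.∣ ℚ.denominatorℕ q)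

In2ℤ₍₂₎ : ℚ → Set
In2ℤ₍₂₎ q = Inℤ₍₂₎ q × ((+ 2) ℤD.∣ ℚ.numerator q)

_·_ : ∀ {n} → MatQ n → MatQ n → MatQ n
(U · V) i j = sumℚ (λ k → U i k ℚ.* V k j)

transpose : ∀ {n} → MatQ n → MatQ n
transpose U i j = U j i

idQ : ∀ {n} → MatQ n
idQ i j with toℕ i ℕ.≟ toℕ j
... | Relation.Nullary.yes _ = 1ℚ
... | Relation.Nullary.no _  = 0ℚ

toMatQ : ∀ {n} → Gram n → MatQ n
toMatQ G i j = G i j / 1

InvertibleOverℤ₍₂₎ : ∀ {n} → MatQ n → Set
InvertibleOverℤ₍₂₎ {n} U =
  (∀ i j → Inℤ₍₂₎ (U i j)) ×
  Σ (MatQ n) λ V → (∀ i j → Inℤ₍₂₎ (V i j)) ×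
    (∀ i j → (U · V) i j ≡ idQ i j) × (∀ i j → (V · U) i j ≡ idQ i j)

-- L₂ has a Jordan decomposition L₂ = L₀ ⊥ L' whose unimodular component L₀
-- has rank r: in a suitable ℤ₍₂₎-basis, the Gram matrix is
-- diag(A, 2C) with A (r×r) unimodular and C ℤ₍₂₎-integral (so 2C splits into
-- the 2^i-modular components, i ≥ 1).
UnimodularComponentRank : ∀ {n} → Gram n → ℕ → Set
UnimodularComponentRank {n} G r =
  Σ (r ℕ.≤ n) λ r≤n →
  Σ (MatQ n) λ U → InvertibleOverℤ₍₂₎ U ×
    let H = transpose U · (toMatQ G · U) in
    InvertibleOverℤ₍₂₎ {r} (λ a b → H (inject≤ a r≤n) (inject≤ b r≤n)) ×
    (∀ i j → toℕ i ℕ.< r → r ℕ.≤ toℕ j → H i j ≡ 0ℚ) ×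
    (∀ i j → r ℕ.≤ toℕ i → toℕ j ℕ.< r → H i j ≡ 0ℚ) ×
    (∀ i j → r ℕ.≤ toℕ i → r ℕ.≤ toℕ j → In2ℤ₍₂₎ (H i j))

{-# OPTIONS --safe #-}
-- Since G is symmetric, Q(x) ≡ ∑ᵢ Gᵢᵢ xᵢ modulo 2 is linear, so Λ₂(L) is the kernel of a linear form L → 𝔽₂.
-- A basis of L can therefore be sheared into a basis of Λ₂(L) that keeps the basis vectors already in Λ₂(L),
-- and a vector of even norm that is primitive in L stays primitive in Λ₂(L).
-- Through the 2-adic change of basis U, B modulo 2 becomes a symmetric form over 𝔽₂ of rank at most 2, and it
-- is not alternating because L represents an odd number. For such a form the zeros of its quadratic form are
-- pairwise orthogonal, so B(Λ₂, Λ₂) ⊆ 2ℤ and the scale s of Λ₂(L) is even. Hence if x is primitive in L with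
-- Q(x) = s·m, then x lies in Λ₂(L), is primitive there, and λ₂(L) primitively represents m.
module Submission where

open import Defs hiding (lincomb)
import Defs
open import Data.Nat using (ℕ; _≤_)
open import Data.Product using (Σ; _×_)
open import Algebra.Bundles using (CommutativeSemiring)
open import Data.Bool.Base using (Bool; _∧_; T)
open import Data.Bool.Properties using (T-∧)
open import Data.Empty using (⊥-elim)
open import Data.Fin.Base using (Fin; zero; suc; toℕ; inject≤)
open import Data.Fin.Properties using (suc-injective; toℕ-injective; any?) renaming (_≟_ to _≟ᶠ_)
open import Data.Integer.Base as ℤ using (ℤ; +_; -[1+_]; -_; ∣_∣; _⊖_)
import Data.Integer.Properties as ℤP
import Data.Integer.Divisibility as ℤD
import Data.Integer.Divisibility.Signed as ℤS
open import Data.Integer.GCD as ℤG using ()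
open import Data.Integer.Tactic.RingSolver using (solve-∀)
open import Data.Nat as ℕ using (zero; suc; z≤n; s≤s; s≤s⁻¹; parity)
import Data.Nat.Properties as ℕP
open import Data.Nat.Divisibility as ℕD using (divides)
open import Data.Nat.GCD as ℕG using ()
open import Data.Parity.Base as ℙ using (Parity; 0ℙ; 1ℙ; _⁻¹)
import Data.Parity.Properties as ℙP
open import Data.Product using (_,_; proj₁; proj₂; ∃)
open import Data.Rational.Base as ℚ using (ℚ; ↥_; ↧_; ↧ₙ_; mkℚ; _/_; 0ℚ)
import Data.Rational.Properties as ℚP
open import Data.Unit.Base using (tt)
open import Data.Vec.Base using (Vec; []; _∷_; lookup)
open import Data.Vec.Functional using (Vector; foldr)
open import Function.Base using (_∘_; flip; id; const)
open import Function.Bundles using (Equivalence)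
open import Relation.Binary.PropositionalEquality as ≡ using (_≡_; _≢_)
open import Relation.Nullary using (¬_; yes; no; contradiction)
open import Relation.Nullary.Decidable using (isYes; toWitness)

module BilinearForms {c ℓ} (R : CommutativeSemiring c ℓ) where

  open CommutativeSemiring R hiding (zero)
  open import Algebra.Properties.Semiring.Sum semiring public
    using (sum; sum-syntax; sum-cong-≋; sum-replicate-zero; ∑-distrib-+; ∑-comm; *-distribˡ-sum; *-distribʳ-sum)
  open import Algebra.Properties.CommutativeSemigroup *-commutativeSemigroup
    using (xy∙z≈zy∙x; x∙yz≈xz∙y)
  open import Relation.Binary.Reasoning.Setoid setoid

  Matrix : ℕ → Set c
  Matrix n = Fin n → Fin n → Carrier

  lincomb : ∀ {k n} → (Fin k → Vector Carrier n) → Vector Carrier k → Vector Carrier n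
  lincomb {k} v x i = ∑[ a < k ] (x a * v a i)

  form : ∀ {n} → Matrix n → Vector Carrier n → Vector Carrier n → Carrier
  form {n} M x y = ∑[ i < n ] ∑[ j < n ] (x i * M i j * y j)

  gram : ∀ {k n} → Matrix n → (Fin k → Vector Carrier n) → Matrix k
  gram M v a b = form M (v a) (v b)

  -- The same case split as idQ, so that the two can be compared by a single `with`.
  1ᴹ : ∀ {n} → Matrix n
  1ᴹ i j with toℕ i ℕ.≟ toℕ j
  ... | yes _ = 1#
  ... | no  _ = 0#

  1ᴹ-diagonal : ∀ {n} (i : Fin n) → 1ᴹ i i ≡ 1#
  1ᴹ-diagonal i with toℕ i ℕ.≟ toℕ i
  ... | yes _   = ≡.refl
  ... | no  i≢i = contradiction ≡.refl i≢i

  1ᴹ-offDiagonal : ∀ {n} {i j : Fin n} → i ≢ j → 1ᴹ i j ≡ 0#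
  1ᴹ-offDiagonal {i = i} {j} i≢j with toℕ i ℕ.≟ toℕ j
  ... | yes i≡j = contradiction (toℕ-injective i≡j) i≢j
  ... | no  _   = ≡.refl

  sum-zero : ∀ {n} (f : Vector Carrier n) → (∀ i → f i ≈ 0#) → sum f ≈ 0#
  sum-zero {n} f f≈0 = trans (sum-cong-≋ f≈0) (sum-replicate-zero n)

  sum-single : ∀ {n} (f : Vector Carrier n) i → (∀ j → j ≢ i → f j ≈ 0#) → sum f ≈ f i
  sum-single f zero    f≈0 = trans (+-congˡ (sum-zero _ (λ j → f≈0 (suc j) λ ()))) (+-identityʳ _)
  sum-single f (suc i) f≈0 = begin
    f zero + sum (f ∘ suc)  ≈⟨ +-congʳ (f≈0 zero λ ()) ⟩
    0# + sum (f ∘ suc)      ≈⟨ +-identityˡ _ ⟩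
    sum (f ∘ suc)           ≈⟨ sum-single (f ∘ suc) i (λ j j≢i → f≈0 (suc j) (j≢i ∘ suc-injective)) ⟩
    f (suc i)               ∎

  ∑-1ᴹ : ∀ {n} i (x : Vector Carrier n) → ∑[ j < n ] (1ᴹ i j * x j) ≈ x i
  ∑-1ᴹ i x = begin
    ∑[ j < _ ] (1ᴹ i j * x j)  ≈⟨ sum-single _ i off-diagonal ⟩
    1ᴹ i i * x i               ≈⟨ *-congʳ (reflexive (1ᴹ-diagonal i)) ⟩
    1# * x i                   ≈⟨ *-identityˡ (x i) ⟩
    x i                        ∎
    where
    off-diagonal : ∀ j → j ≢ i → 1ᴹ i j * x j ≈ 0#
    off-diagonal j j≢i = trans (*-congʳ (reflexive (1ᴹ-offDiagonal (j≢i ∘ ≡.sym)))) (zeroˡ (x j))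

  ∑-shift : ∀ {k} (i : Fin k) m (x f : Vector Carrier k) →
            ∑[ b < k ] ((x b + m * 1ᴹ i b) * f b) ≈ ∑[ b < k ] (x b * f b) + m * f i
  ∑-shift {k} i m x f = begin
    ∑[ b < k ] ((x b + m * 1ᴹ i b) * f b)
      ≈⟨ sum-cong-≋ (λ b → distribʳ (f b) (x b) (m * 1ᴹ i b)) ⟩
    ∑[ b < k ] (x b * f b + m * 1ᴹ i b * f b)
      ≈⟨ ∑-distrib-+ (λ b → x b * f b) (λ b → m * 1ᴹ i b * f b) ⟩
    ∑[ b < k ] (x b * f b) + ∑[ b < k ] (m * 1ᴹ i b * f b)
      ≈⟨ +-congˡ (sum-cong-≋ (λ b → *-assoc m (1ᴹ i b) (f b))) ⟩
    ∑[ b < k ] (x b * f b) + ∑[ b < k ] (m * (1ᴹ i b * f b))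
      ≈⟨ +-congˡ (sym (*-distribˡ-sum m (λ b → 1ᴹ i b * f b))) ⟩
    ∑[ b < k ] (x b * f b) + m * ∑[ b < k ] (1ᴹ i b * f b)
      ≈⟨ +-congˡ (*-congˡ (∑-1ᴹ i f)) ⟩
    ∑[ b < k ] (x b * f b) + m * f i
      ∎

  sum-restrict : ∀ {r n} (r≤n : r ℕ.≤ n) (f : Vector Carrier n) →
                 (∀ i → r ℕ.≤ toℕ i → f i ≈ 0#) → sum f ≈ ∑[ a < r ] f (inject≤ a r≤n)
  sum-restrict {ℕ.zero}  _ f f≈0 = sum-zero f (λ i → f≈0 i z≤n)
  sum-restrict {ℕ.suc r} {ℕ.suc n} r≤n f f≈0 =
    +-congˡ (sum-restrict (s≤s⁻¹ r≤n) (f ∘ suc) (λ i r≤i → f≈0 (suc i) (s≤s r≤i)))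

  form-cong : ∀ {n} {M M' : Matrix n} {x x' y y'} → (∀ i j → M i j ≈ M' i j) →
              (∀ i → x i ≈ x' i) → (∀ i → y i ≈ y' i) → form M x y ≈ form M' x' y'
  form-cong M≈M' x≈x' y≈y' =
    sum-cong-≋ (λ i → sum-cong-≋ (λ j → *-cong (*-cong (x≈x' i) (M≈M' i j)) (y≈y' j)))

  form-transpose : ∀ {n} (M : Matrix n) x y → form M x y ≈ form (flip M) y x
  form-transpose M x y =
    trans (∑-comm (λ i j → x i * M i j * y j)) (sum-cong-≋ (λ j → sum-cong-≋ (λ i → xy∙z≈zy∙x (x i) (M i j) (y j))))

  form-sym : ∀ {n} {M : Matrix n} → (∀ i j → M i j ≈ M j i) → ∀ x y → form M x y ≈ form M y x
  form-sym M-sym x y =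
    trans (form-transpose _ x y) (form-cong (λ i j → M-sym j i) (λ _ → refl) (λ _ → refl))

  form-nested : ∀ {n} (M : Matrix n) x y → form M x y ≈ ∑[ i < n ] (x i * ∑[ j < n ] (M i j * y j))
  form-nested {n} M x y = sum-cong-≋ (λ i → sym (trans (*-distribˡ-sum (x i) (λ j → M i j * y j))
    (sum-cong-≋ (λ j → sym (*-assoc (x i) (M i j) (y j))))))

  form-restrict : ∀ {r n} (r≤n : r ℕ.≤ n) (M : Matrix n) x y →
    (∀ i j → r ℕ.≤ toℕ i → M i j ≈ 0#) → (∀ i j → r ℕ.≤ toℕ j → M i j ≈ 0#) →
    form M x y ≈ form (λ a b → M (inject≤ a r≤n) (inject≤ b r≤n))
                      (λ a → x (inject≤ a r≤n)) (λ b → y (inject≤ b r≤n))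
  form-restrict {n = n} r≤n M x y rows cols =
    trans (sum-restrict r≤n (λ i → ∑[ j < n ] (x i * M i j * y j))
                        (λ i r≤i → sum-zero _ (λ j → term-zero (x i) (y j) (rows i j r≤i))))
          (sum-cong-≋ (λ a → sum-restrict r≤n (λ j → x (ι a) * M (ι a) j * y j)
                                          (λ j r≤j → term-zero (x (ι a)) (y j) (cols (ι a) j r≤j))))
    where
    ι = λ a → inject≤ a r≤n
    term-zero : ∀ u w {m} → m ≈ 0# → u * m * w ≈ 0#
    term-zero u w m≈0 = trans (*-congʳ (trans (*-congˡ m≈0) (zeroʳ u))) (zeroˡ w)

  form-lincombˡ : ∀ {k n} (M : Matrix n) (v : Fin k → Vector Carrier n) c y →
                  form M (lincomb v c) y ≈ ∑[ a < k ] (c a * form M (v a) y)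
  form-lincombˡ {k} {n} M v c y = begin
    ∑[ i < n ] ∑[ j < n ] (lincomb v c i * M i j * y j)
      ≈⟨ sum-cong-≋ (λ i → sum-cong-≋ (λ j → expand i j)) ⟩
    ∑[ i < n ] ∑[ j < n ] ∑[ a < k ] (c a * (v a i * M i j * y j))
      ≈⟨ sum-cong-≋ (λ i → ∑-comm (λ j a → c a * (v a i * M i j * y j))) ⟩
    ∑[ i < n ] ∑[ a < k ] ∑[ j < n ] (c a * (v a i * M i j * y j))
      ≈⟨ ∑-comm (λ i a → ∑[ j < n ] (c a * (v a i * M i j * y j))) ⟩
    ∑[ a < k ] ∑[ i < n ] ∑[ j < n ] (c a * (v a i * M i j * y j))
      ≈⟨ sum-cong-≋ (λ a → sym (trans (*-distribˡ-sum (c a) (λ i → ∑[ j < n ] (v a i * M i j * y j)))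
           (sum-cong-≋ (λ i → *-distribˡ-sum (c a) (λ j → v a i * M i j * y j))))) ⟩
    ∑[ a < k ] (c a * form M (v a) y)
      ∎
    where
    expand : ∀ i j → lincomb v c i * M i j * y j ≈ ∑[ a < k ] (c a * (v a i * M i j * y j))
    expand i j = begin
      lincomb v c i * M i j * y j               ≈⟨ *-congʳ (*-distribʳ-sum (M i j) (λ a → c a * v a i)) ⟩
      ∑[ a < k ] (c a * v a i * M i j) * y j    ≈⟨ *-distribʳ-sum (y j) (λ a → c a * v a i * M i j) ⟩
      ∑[ a < k ] (c a * v a i * M i j * y j)    ≈⟨ sum-cong-≋ (λ a → trans (*-congʳ (*-assoc (c a) (v a i) (M i j)))
                                                                        (*-assoc (c a) (v a i * M i j) (y j))) ⟩
      ∑[ a < k ] (c a * (v a i * M i j * y j))  ∎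

  form-lincombʳ : ∀ {k n} (M : Matrix n) (v : Fin k → Vector Carrier n) d x →
                  form M x (lincomb v d) ≈ ∑[ b < k ] (d b * form M x (v b))
  form-lincombʳ M v d x = trans (form-transpose M x (lincomb v d)) (trans (form-lincombˡ (flip M) v d x)
    (sum-cong-≋ (λ b → *-congˡ (sym (form-transpose M x (v b))))))

  form-lincomb : ∀ {k n} (M : Matrix n) (v : Fin k → Vector Carrier n) c d →
                 form M (lincomb v c) (lincomb v d) ≈ form (gram M v) c d
  form-lincomb {k} M v c d = begin
    form M (lincomb v c) (lincomb v d)
      ≈⟨ form-lincombˡ M v c (lincomb v d) ⟩
    ∑[ a < k ] (c a * form M (v a) (lincomb v d))
      ≈⟨ sum-cong-≋ (λ a → *-congˡ (form-lincombʳ M v d (v a))) ⟩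
    ∑[ a < k ] (c a * ∑[ b < k ] (d b * gram M v a b))
      ≈⟨ sum-cong-≋ (λ a → trans (*-distribˡ-sum (c a) (λ b → d b * gram M v a b))
                                   (sum-cong-≋ (λ b → x∙yz≈xz∙y (c a) (d b) (gram M v a b)))) ⟩
    form (gram M v) c d
      ∎

  lincomb-inverse : ∀ {n} (U V : Matrix n) → (∀ i j → ∑[ k < n ] (U i k * V k j) ≈ 1ᴹ i j) →
                    ∀ x i → lincomb (flip U) (lincomb (flip V) x) i ≈ x i
  lincomb-inverse {n} U V UV≈1 x i = begin
    ∑[ k < n ] (∑[ j < n ] (x j * V k j) * U i k)  ≈⟨ sum-cong-≋ (λ k → *-distribʳ-sum (U i k) (λ j → x j * V k j)) ⟩
    ∑[ k < n ] ∑[ j < n ] (x j * V k j * U i k)    ≈⟨ ∑-comm (λ k j → x j * V k j * U i k) ⟩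
    ∑[ j < n ] ∑[ k < n ] (x j * V k j * U i k)    ≈⟨ sum-cong-≋ (λ j → sym (trans (*-distribˡ-sum (x j) (λ k → U i k * V k j))
                                                        (sum-cong-≋ (λ k → x∙yz≈xz∙y (x j) (U i k) (V k j))))) ⟩
    ∑[ j < n ] (x j * ∑[ k < n ] (U i k * V k j))  ≈⟨ sum-cong-≋ (λ j → trans (*-congˡ (UV≈1 i j)) (*-comm (x j) (1ᴹ i j))) ⟩
    ∑[ j < n ] (1ᴹ i j * x j)                      ≈⟨ ∑-1ᴹ i x ⟩
    x i                                            ∎

open ≡ using (refl; sym; trans; cong; cong₂; subst; module ≡-Reasoning)

parityℤ : ℤ → Parity
parityℤ i = parity ∣ i ∣

parity-suc : ∀ m → parity (suc m) ≡ parity m ⁻¹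
parity-suc m = ℙP.+-homo-+ 1 m

⁻¹+⁻¹ : ∀ p q → p ⁻¹ ℙ.+ q ⁻¹ ≡ p ℙ.+ q
⁻¹+⁻¹ 0ℙ q = ℙP.⁻¹-involutive q
⁻¹+⁻¹ 1ℙ q = refl

parity-⊖ : ∀ m n → parity ∣ m ⊖ n ∣ ≡ parity m ℙ.+ parity n
parity-⊖ zero    zero    = refl
parity-⊖ zero    (suc n) = refl
parity-⊖ (suc m) zero    = sym (ℙP.+-identityʳ _)
parity-⊖ (suc m) (suc n) = begin
  parity ∣ suc m ⊖ suc n ∣              ≡⟨ cong (parity ∘ ∣_∣) (ℤP.[1+m]⊖[1+n]≡m⊖n m n) ⟩
  parity ∣ m ⊖ n ∣                      ≡⟨ parity-⊖ m n ⟩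
  parity m ℙ.+ parity n                 ≡⟨ ⁻¹+⁻¹ (parity m) (parity n) ⟨
  parity m ⁻¹ ℙ.+ parity n ⁻¹           ≡⟨ cong₂ ℙ._+_ (parity-suc m) (parity-suc n) ⟨
  parity (suc m) ℙ.+ parity (suc n)     ∎
  where open ≡-Reasoning

parityℤ-+ : ∀ i j → parityℤ (i ℤ.+ j) ≡ parityℤ i ℙ.+ parityℤ j
parityℤ-+ (+ m)    (+ n)    = ℙP.+-homo-+ m n
parityℤ-+ (+ m)    -[1+ n ] = parity-⊖ m (suc n)
parityℤ-+ -[1+ m ] (+ n)    = trans (parity-⊖ n (ℕ.suc m)) (ℙP.+-comm (parity n) (parity (ℕ.suc m)))
parityℤ-+ -[1+ m ] -[1+ n ] = trans (ℙP.+-homo-+ m n) (sym (trans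
  (cong₂ ℙ._+_ (parity-suc m) (parity-suc n)) (⁻¹+⁻¹ (parity m) (parity n))))

parityℤ-* : ∀ i j → parityℤ (i ℤ.* j) ≡ parityℤ i ℙ.* parityℤ j
parityℤ-* i j = trans (cong parity (ℤP.abs-* i j)) (ℙP.*-homo-* ∣ i ∣ ∣ j ∣)

parity≡0⇒2∣ : ∀ n → parity n ≡ 0ℙ → 2 ℕD.∣ n
parity≡0⇒2∣ zero          _  = ℕD._∣0 2
parity≡0⇒2∣ (suc (suc n)) eq with parity≡0⇒2∣ n eq
... | divides q n≡q*2 = divides (suc q) (cong (2 ℕ.+_) n≡q*2)

2∣⇒parity≡0 : ∀ {n} → 2 ℕD.∣ n → parity n ≡ 0ℙ
2∣⇒parity≡0 (divides q refl) = trans (ℙP.*-homo-* q 2) (ℙP.*-zeroʳ (parity q))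

parity≡1⇒2∤ : ∀ {n} → parity n ≡ 1ℙ → ¬ 2 ℕD.∣ n
parity≡1⇒2∤ odd 2∣n with trans (sym odd) (2∣⇒parity≡0 2∣n)
... | ()

2∤⇒parity≡1 : ∀ n → ¬ 2 ℕD.∣ n → parity n ≡ 1ℙ
2∤⇒parity≡1 n 2∤n with parity n in eq
... | 0ℙ = ⊥-elim (2∤n (parity≡0⇒2∣ n eq))
... | 1ℙ = refl

open BilinearForms ℙP.+-*-commutativeSemiring
module Overℤ = BilinearForms ℤP.+-*-commutativeSemiring

-- q ∈ ℤ₍₂₎ and a is its image in ℤ₍₂₎/2ℤ₍₂₎ ≅ 𝔽₂
record Residue (q : ℚ) (a : Parity) : Set where
  constructor residue
  field
    integral : Inℤ₍₂₎ q
    parity-numerator : parityℤ (↥ q) ≡ a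

residue-unique : ∀ {q a b} → Residue q a → Residue q b → a ≡ b
residue-unique (residue _ refl) (residue _ refl) = refl

*≡1ℙ⇒≡1ℙ : ∀ p q → p ℙ.* q ≡ 1ℙ → p ≡ 1ℙ × q ≡ 1ℙ
*≡1ℙ⇒≡1ℙ 1ℙ q q≡1 = refl , q≡1

residue-/ : ∀ i n .{{_ : ℕ.NonZero n}} → parity n ≡ 1ℙ → Residue (i / n) (parityℤ i)
residue-/ i n n-odd = residue (parity≡1⇒2∤ den-odd) num
  where
  r = i / n
  g = ℤG.gcd i (+ n)
  factors-odd : parityℤ (↧ r) ℙ.* parityℤ g ≡ 1ℙ
  factors-odd = trans (sym (parityℤ-* (↧ r) g)) (trans (cong parityℤ (ℚP.↧-/ i n)) n-odd)
  den-odd = proj₁ (*≡1ℙ⇒≡1ℙ _ _ factors-odd)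
  num : parityℤ (↥ r) ≡ parityℤ i
  num = begin
    parityℤ (↥ r)                  ≡⟨ ℙP.*-identityʳ _ ⟨
    parityℤ (↥ r) ℙ.* 1ℙ           ≡⟨ cong (parityℤ (↥ r) ℙ.*_) (proj₂ (*≡1ℙ⇒≡1ℙ _ _ factors-odd)) ⟨
    parityℤ (↥ r) ℙ.* parityℤ g    ≡⟨ parityℤ-* (↥ r) g ⟨
    parityℤ (↥ r ℤ.* g)            ≡⟨ cong parityℤ (ℚP.↥-/ i n) ⟩
    parityℤ i                      ∎
    where open ≡-Reasoning

residue-int : ∀ z → Residue (z / 1) (parityℤ z)
residue-int z = residue-/ z 1 refl

denominator-odd : ∀ {q a} → Residue q a → parityℤ (↧ q) ≡ 1ℙ
denominator-odd (residue q∈ℤ₍₂₎ _) = 2∤⇒parity≡1 _ q∈ℤ₍₂₎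

residue-+ : ∀ {p q a b} → Residue p a → Residue q b → Residue (p ℚ.+ q) (a ℙ.+ b)
residue-+ {p@(mkℚ _ _ _)} {q@(mkℚ _ _ _)} {a} {b} rp@(residue _ refl) rq@(residue _ refl) =
  residue (Residue.integral sum-residue) (trans (Residue.parity-numerator sum-residue) (begin
    parityℤ (↥ p ℤ.* ↧ q ℤ.+ ↥ q ℤ.* ↧ p)
      ≡⟨ parityℤ-+ (↥ p ℤ.* ↧ q) _ ⟩
    parityℤ (↥ p ℤ.* ↧ q) ℙ.+ parityℤ (↥ q ℤ.* ↧ p)
      ≡⟨ cong₂ ℙ._+_ (parityℤ-* (↥ p) (↧ q)) (parityℤ-* (↥ q) (↧ p)) ⟩
    (a ℙ.* parityℤ (↧ q)) ℙ.+ (b ℙ.* parityℤ (↧ p))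
      ≡⟨ cong₂ (λ s t → (a ℙ.* s) ℙ.+ (b ℙ.* t)) (denominator-odd rq) (denominator-odd rp) ⟩
    (a ℙ.* 1ℙ) ℙ.+ (b ℙ.* 1ℙ)
      ≡⟨ cong₂ ℙ._+_ (ℙP.*-identityʳ a) (ℙP.*-identityʳ b) ⟩
    a ℙ.+ b ∎))
  where
  open ≡-Reasoning
  sum-residue = residue-/ (↥ p ℤ.* ↧ q ℤ.+ ↥ q ℤ.* ↧ p) (↧ₙ p ℕ.* ↧ₙ q)
    (trans (ℙP.*-homo-* (↧ₙ p) (↧ₙ q)) (cong₂ ℙ._*_ (denominator-odd rp) (denominator-odd rq)))

residue-* : ∀ {p q a b} → Residue p a → Residue q b → Residue (p ℚ.* q) (a ℙ.* b)
residue-* {p@(mkℚ _ _ _)} {q@(mkℚ _ _ _)} rp@(residue _ refl) rq@(residue _ refl) =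
  residue (Residue.integral product-residue) (trans (Residue.parity-numerator product-residue) (parityℤ-* (↥ p) (↥ q)))
  where
  product-residue = residue-/ (↥ p ℤ.* ↥ q) (↧ₙ p ℕ.* ↧ₙ q)
    (trans (ℙP.*-homo-* (↧ₙ p) (↧ₙ q)) (cong₂ ℙ._*_ (denominator-odd rp) (denominator-odd rq)))

residue-0ℚ : Residue 0ℚ 0ℙ
residue-0ℚ = residue (parity≡1⇒2∤ refl) refl

residue-sum : ∀ {n} {f : Fin n → ℚ} {g : Vector Parity n} →
              (∀ i → Residue (f i) (g i)) → Residue (sumℚ f) (sum g)
residue-sum {ℕ.zero}  _   = residue-0ℚ
residue-sum {ℕ.suc n} f↦g = residue-+ (f↦g zero) (residue-sum (f↦g ∘ suc))

residue-· : ∀ {n} {P R : MatQ n} {P̄ R̄ : Matrix n} →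
            (∀ i j → Residue (P i j) (P̄ i j)) → (∀ i j → Residue (R i j) (R̄ i j)) →
            ∀ i j → Residue ((P · R) i j) (∑[ k < n ] (P̄ i k ℙ.* R̄ k j))
residue-· P↦P̄ R↦R̄ i j = residue-sum (λ k → residue-* (P↦P̄ i k) (R↦R̄ k j))

residue-idQ : ∀ {n} (i j : Fin n) → Residue (idQ i j) (1ᴹ i j)
residue-idQ i j with toℕ i ℕ.≟ toℕ j
... | yes _ = residue (parity≡1⇒2∤ refl) refl
... | no  _ = residue-0ℚ

residue-In2ℤ₍₂₎ : ∀ {q} → In2ℤ₍₂₎ q → Residue q 0ℙ
residue-In2ℤ₍₂₎ (q∈ℤ₍₂₎ , 2∣q) = residue q∈ℤ₍₂₎ (2∣⇒parity≡0 2∣q)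

∑∑-symmetric : ∀ {n} (f : Fin n → Fin n → Parity) → (∀ a b → f a b ≡ f b a) →
               ∑[ a < n ] ∑[ b < n ] f a b ≡ ∑[ a < n ] f a a
∑∑-symmetric {ℕ.zero}  f f-sym = refl
∑∑-symmetric {ℕ.suc n} f f-sym = begin
  (f zero zero ℙ.+ R) ℙ.+ ∑[ a < n ] (f (suc a) zero ℙ.+ ∑[ b < n ] f (suc a) (suc b))
    ≡⟨ cong ((f zero zero ℙ.+ R) ℙ.+_) (∑-distrib-+ (λ a → f (suc a) zero) (λ a → ∑[ b < n ] f (suc a) (suc b))) ⟩
  (f zero zero ℙ.+ R) ℙ.+ (∑[ a < n ] f (suc a) zero ℙ.+ ∑[ a < n ] ∑[ b < n ] f (suc a) (suc b))
    ≡⟨ cong₂ (λ s t → (f zero zero ℙ.+ R) ℙ.+ (s ℙ.+ t))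
             (sum-cong-≋ (λ a → f-sym (suc a) zero))
             (∑∑-symmetric (λ a b → f (suc a) (suc b)) (λ a b → f-sym (suc a) (suc b))) ⟩
  (f zero zero ℙ.+ R) ℙ.+ (R ℙ.+ ∑[ a < n ] f (suc a) (suc a))
    ≡⟨ cancel (f zero zero) R _ ⟩
  f zero zero ℙ.+ ∑[ a < n ] f (suc a) (suc a)
    ∎
  where
  open ≡-Reasoning
  R = ∑[ b < n ] f zero (suc b)
  cancel : ∀ p r q → (p ℙ.+ r) ℙ.+ (r ℙ.+ q) ≡ p ℙ.+ q
  cancel 0ℙ 0ℙ q = refl
  cancel 0ℙ 1ℙ q = ℙP.⁻¹-involutive q
  cancel 1ℙ 0ℙ q = refl
  cancel 1ℙ 1ℙ q = refl

-- In characteristic 2 the cross terms cancel in pairs and z² = z, so the quadratic form is linear.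
form-diagonal : ∀ {n} {M : Matrix n} → (∀ i j → M i j ≡ M j i) →
                ∀ z → form M z z ≡ ∑[ i < n ] (z i ℙ.* M i i)
form-diagonal {M = M} M-sym z = trans
  (∑∑-symmetric (λ i j → (z i ℙ.* M i j) ℙ.* z j)
                (λ i j → trans (cong (λ m → (z i ℙ.* m) ℙ.* z j) (M-sym i j)) (swap (z i) (M j i) (z j))))
  (sum-cong-≋ (λ i → idempotent (z i) (M i i)))
  where
  swap : ∀ p m q → (p ℙ.* m) ℙ.* q ≡ (q ℙ.* m) ℙ.* p
  swap 0ℙ m 0ℙ = refl
  swap 0ℙ m 1ℙ = sym (ℙP.*-zeroʳ m)
  swap 1ℙ m 0ℙ = ℙP.*-zeroʳ m
  swap 1ℙ m 1ℙ = refl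
  idempotent : ∀ p m → (p ℙ.* m) ℙ.* p ≡ p ℙ.* m
  idempotent 0ℙ m = refl
  idempotent 1ℙ m = ℙP.*-identityʳ m

-- Equals 1ℙ exactly when β(u,u) = 1 while x and y are zeros of the quadratic form with β(x,y) = 1.
isotropy-defect : {V : Set} → (V → V → Parity) → V → V → V → Parity
isotropy-defect β u x y = β u u ℙ.* ((1ℙ ℙ.+ β x x) ℙ.* ((1ℙ ℙ.+ β y y) ℙ.* β x y))

isotropy-defect-pullback : {V W : Set} (β : V → V → Parity) (β' : W → W → Parity) (f : V → W) →
  (∀ a b → β a b ≡ β' (f a) (f b)) → ∀ u x y → isotropy-defect β u x y ≡ isotropy-defect β' (f u) (f x) (f y)
isotropy-defect-pullback β β' f β≡β' u x y =
  cong₂ ℙ._*_ (β≡β' u u)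
    (cong₂ ℙ._*_ (cong (1ℙ ℙ.+_) (β≡β' x x)) (cong₂ ℙ._*_ (cong (1ℙ ℙ.+_) (β≡β' y y)) (β≡β' x y)))

isotropy-defect-zero : ∀ {p q s t} → p ℙ.* ((1ℙ ℙ.+ q) ℙ.* ((1ℙ ℙ.+ s) ℙ.* t)) ≡ 0ℙ →
                       p ≡ 1ℙ → q ≡ 0ℙ → s ≡ 0ℙ → t ≡ 0ℙ
isotropy-defect-zero t≡0 refl refl refl = t≡0

allZero : ∀ k → (Vec Parity k → Parity) → Bool
allZero ℕ.zero    F = isYes (F [] ℙP.≟ 0ℙ)
allZero (ℕ.suc k) F = allZero k (F ∘ (0ℙ ∷_)) ∧ allZero k (F ∘ (1ℙ ∷_))

allZero-sound : ∀ k F → T (allZero k F) → ∀ v → F v ≡ 0ℙ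
allZero-sound ℕ.zero    F F≡0 []       = toWitness F≡0
allZero-sound (ℕ.suc k) F F≡0 (0ℙ ∷ v) = allZero-sound k _ (proj₁ (Equivalence.to T-∧ F≡0)) v
allZero-sound (ℕ.suc k) F F≡0 (1ℙ ∷ v) = allZero-sound k _ (proj₂ (Equivalence.to T-∧ F≡0)) v

symmetric₂ : Parity → Parity → Parity → Matrix 2
symmetric₂ a b d i j = lookup (lookup ((a ∷ b ∷ []) ∷ (b ∷ d ∷ []) ∷ []) i) j

-- By exhaustive evaluation. Symmetry is needed: some non-symmetric 2 × 2 matrices have defect 1ℙ.
isotropy-defect-vanishes : ∀ {r} → r ℕ.≤ 2 → (A : Matrix r) → (∀ a b → A a b ≡ A b a) →
                           ∀ u x y → isotropy-defect (form A) u x y ≡ 0ℙ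
isotropy-defect-vanishes z≤n A _ u x y = refl
isotropy-defect-vanishes (s≤s z≤n) A _ u x y =
  allZero-sound 4 rank₁ _ (A zero zero ∷ u zero ∷ x zero ∷ y zero ∷ [])
  where
  rank₁ : Vec Parity 4 → Parity
  rank₁ (a ∷ u₀ ∷ x₀ ∷ y₀ ∷ []) = isotropy-defect (form {1} (λ _ _ → a)) (λ _ → u₀) (λ _ → x₀) (λ _ → y₀)
isotropy-defect-vanishes (s≤s (s≤s z≤n)) A A-sym u x y = trans
  (isotropy-defect-pullback (form A) (form A₂) id
    (λ v w → form-cong {x = v} {y = w} A≡A₂ (λ _ → refl) (λ _ → refl)) u x y)
  (allZero-sound 9 rank₂ _ (a ∷ b ∷ d ∷ u zero ∷ u (suc zero) ∷ x zero ∷ x (suc zero) ∷ y zero ∷ y (suc zero) ∷ []))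
  where
  a = A zero zero
  b = A zero (suc zero)
  d = A (suc zero) (suc zero)
  A₂ = symmetric₂ a b d
  A≡A₂ : ∀ i j → A i j ≡ A₂ i j
  A≡A₂ zero       zero       = refl
  A≡A₂ zero       (suc zero) = refl
  A≡A₂ (suc zero) zero       = A-sym (suc zero) zero
  A≡A₂ (suc zero) (suc zero) = refl
  rank₂ : Vec Parity 9 → Parity
  rank₂ (a ∷ b ∷ d ∷ u₀ ∷ u₁ ∷ x₀ ∷ x₁ ∷ y₀ ∷ y₁ ∷ []) =
    isotropy-defect (form (symmetric₂ a b d)) (lookup (u₀ ∷ u₁ ∷ [])) (lookup (x₀ ∷ x₁ ∷ [])) (lookup (y₀ ∷ y₁ ∷ []))

mod₂ : ∀ {n} → Vecℤ n → Vector Parity n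
mod₂ x i = parityℤ (x i)

mod₂ᴹ : ∀ {n} → Gram n → Matrix n
mod₂ᴹ G i j = parityℤ (G i j)

parityℤ-sumℤ : ∀ {n} (f : Fin n → ℤ) → parityℤ (sumℤ f) ≡ ∑[ i < n ] parityℤ (f i)
parityℤ-sumℤ {ℕ.zero}  f = refl
parityℤ-sumℤ {ℕ.suc n} f =
  trans (parityℤ-+ (f zero) (sumℤ (f ∘ suc))) (cong (parityℤ (f zero) ℙ.+_) (parityℤ-sumℤ (f ∘ suc)))

parity-B : ∀ {n} (G : Gram n) x y → parityℤ (B G x y) ≡ form (mod₂ᴹ G) (mod₂ x) (mod₂ y)
parity-B G x y = trans (parityℤ-sumℤ (λ i → sumℤ (λ j → x i ℤ.* G i j ℤ.* y j)))
  (sum-cong-≋ (λ i → trans (parityℤ-sumℤ (λ j → x i ℤ.* G i j ℤ.* y j)) (sum-cong-≋ (λ j →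
  trans (parityℤ-* (x i ℤ.* G i j) (y j)) (cong (ℙ._* parityℤ (y j)) (parityℤ-* (x i) (G i j)))))))

mod₂-lincomb : ∀ {k n} (v : Fin k → Vecℤ n) c i → mod₂ (Defs.lincomb v c) i ≡ lincomb (mod₂ ∘ v) (mod₂ c) i
mod₂-lincomb v c i = trans (parityℤ-sumℤ (λ a → c a ℤ.* v a i)) (sum-cong-≋ (λ a → parityℤ-* (c a) (v a i)))

mod₂ᴹ-sym : ∀ {n} {G : Gram n} → Symmetric G → ∀ i j → mod₂ᴹ G i j ≡ mod₂ᴹ G j i
mod₂ᴹ-sym G-sym i j = cong parityℤ (G-sym i j)

parity-Q-lincomb : ∀ {k n} (G : Gram n) → Symmetric G → (v : Fin k → Vecℤ n) (c : Fin k → ℤ) →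
  parityℤ (Q G (Defs.lincomb v c)) ≡ ∑[ b < k ] (parityℤ (c b) ℙ.* parityℤ (Q G (v b)))
parity-Q-lincomb {k} G G-sym v c = begin
  parityℤ (Q G (Defs.lincomb v c))
    ≡⟨ parity-B G (Defs.lincomb v c) (Defs.lincomb v c) ⟩
  form Ḡ (mod₂ (Defs.lincomb v c)) (mod₂ (Defs.lincomb v c))
    ≡⟨ form-cong (λ _ _ → refl) (mod₂-lincomb v c) (mod₂-lincomb v c) ⟩
  form Ḡ (lincomb v̄ c̄) (lincomb v̄ c̄)
    ≡⟨ form-lincomb Ḡ v̄ c̄ c̄ ⟩
  form (gram Ḡ v̄) c̄ c̄
    ≡⟨ form-diagonal (λ a b → form-sym (mod₂ᴹ-sym G-sym) (v̄ a) (v̄ b)) c̄ ⟩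
  ∑[ b < k ] (c̄ b ℙ.* form Ḡ (v̄ b) (v̄ b))
    ≡⟨ sum-cong-≋ (λ b → cong (c̄ b ℙ.*_) (sym (parity-B G (v b) (v b)))) ⟩
  ∑[ b < k ] (c̄ b ℙ.* parityℤ (Q G (v b)))
    ∎
  where
  open ≡-Reasoning
  Ḡ = mod₂ᴹ G
  v̄ = mod₂ ∘ v
  c̄ = mod₂ c

residue-congruence : ∀ {n} (G : Gram n) {U : MatQ n} {Ū : Matrix n} → (∀ i j → Residue (U i j) (Ū i j)) →
                     ∀ k l → Residue ((transpose U · (toMatQ G · U)) k l) (gram (mod₂ᴹ G) (flip Ū) k l)
residue-congruence G {Ū = Ū} U↦Ū k l =
  subst (Residue _) (sym (form-nested (mod₂ᴹ G) (flip Ū k) (flip Ū l)))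
        (residue-· (λ i j → U↦Ū j i) (residue-· (λ i j → residue-int (G i j)) U↦Ū) k l)

residue-inverse : ∀ {n} {U V : MatQ n} {Ū V̄ : Matrix n} →
                  (∀ i j → Residue (U i j) (Ū i j)) → (∀ i j → Residue (V i j) (V̄ i j)) →
                  (∀ i j → (U · V) i j ≡ idQ i j) → ∀ i j → ∑[ k < n ] (Ū i k ℙ.* V̄ k j) ≡ 1ᴹ i j
residue-inverse U↦Ū V↦V̄ U·V≡1 i j =
  residue-unique (residue-· U↦Ū V↦V̄ i j) (subst (λ q → Residue q (1ᴹ i j)) (sym (U·V≡1 i j)) (residue-idQ i j))

parity-B-factors : ∀ {n r} (G : Gram n) → Symmetric G → UnimodularComponentRank G r →
  Σ (Matrix r) λ A → (∀ a b → A a b ≡ A b a) ×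
  Σ (Vecℤ n → Vector Parity r) λ f → ∀ x y → parityℤ (B G x y) ≡ form A (f x) (f y)
parity-B-factors {n} {r} G G-sym
  (r≤n , U , (U-integral , V , V-integral , U·V≡1 , _) , _ , upper-right , lower-left , lower-right) =
  A , (λ a b → form-sym (mod₂ᴹ-sym G-sym) (flip Ū (ι a)) (flip Ū (ι b))) , f , factor
  where
  Ū V̄ Ḡ H̄ : Matrix n
  Ū i j = parityℤ (↥ U i j)
  V̄ i j = parityℤ (↥ V i j)
  Ḡ = mod₂ᴹ G
  H̄ = gram Ḡ (flip Ū)
  ι : Fin r → Fin n
  ι a = inject≤ a r≤n
  A : Matrix r
  A a b = H̄ (ι a) (ι b)
  coordinates : Vecℤ n → Vector Parity n
  coordinates x = lincomb (flip V̄) (mod₂ x)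
  f : Vecℤ n → Vector Parity r
  f x = coordinates x ∘ ι

  H↦H̄ : ∀ k l → Residue ((transpose U · (toMatQ G · U)) k l) (H̄ k l)
  H↦H̄ = residue-congruence G {U} (λ i j → residue (U-integral i j) refl)

  H̄-rows : ∀ k l → r ℕ.≤ toℕ k → H̄ k l ≡ 0ℙ
  H̄-rows k l r≤k with r ℕ.≤? toℕ l
  ... | yes r≤l = residue-unique (H↦H̄ k l) (residue-In2ℤ₍₂₎ (lower-right k l r≤k r≤l))
  ... | no  r≰l = residue-unique (H↦H̄ k l)
                    (subst (λ q → Residue q 0ℙ) (sym (lower-left k l r≤k (ℕP.≰⇒> r≰l))) residue-0ℚ)

  H̄-cols : ∀ k l → r ℕ.≤ toℕ l → H̄ k l ≡ 0ℙ
  H̄-cols k l r≤l with r ℕ.≤? toℕ k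
  ... | yes r≤k = H̄-rows k l r≤k
  ... | no  r≰k = residue-unique (H↦H̄ k l)
                    (subst (λ q → Residue q 0ℙ) (sym (upper-right k l (ℕP.≰⇒> r≰k) r≤l)) residue-0ℚ)

  x̄≡Ū·coordinates : ∀ x i → mod₂ x i ≡ lincomb (flip Ū) (coordinates x) i
  x̄≡Ū·coordinates x = sym ∘ lincomb-inverse Ū V̄
    (residue-inverse {U = U} {V} (λ i j → residue (U-integral i j) refl) (λ i j → residue (V-integral i j) refl) U·V≡1)
    (mod₂ x)

  factor : ∀ x y → parityℤ (B G x y) ≡ form A (f x) (f y)
  factor x y = begin
    parityℤ (B G x y)
      ≡⟨ parity-B G x y ⟩
    form Ḡ (mod₂ x) (mod₂ y)
      ≡⟨ form-cong (λ _ _ → refl) (x̄≡Ū·coordinates x) (x̄≡Ū·coordinates y) ⟩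
    form Ḡ (lincomb (flip Ū) (coordinates x)) (lincomb (flip Ū) (coordinates y))
      ≡⟨ form-lincomb Ḡ (flip Ū) (coordinates x) (coordinates y) ⟩
    form H̄ (coordinates x) (coordinates y)
      ≡⟨ form-restrict r≤n H̄ (coordinates x) (coordinates y) H̄-rows H̄-cols ⟩
    form A (f x) (f y)
      ∎
    where open ≡-Reasoning

Λ₂-isotropic : ∀ {n r} (G : Gram n) → Symmetric G → r ℕ.≤ 2 → UnimodularComponentRank G r →
  ∀ x₀ → parityℤ (Q G x₀) ≡ 1ℙ → ∀ x y → Λ₂ G x → Λ₂ G y → parityℤ (B G x y) ≡ 0ℙ
Λ₂-isotropic G G-sym r≤2 rank x₀ Q-odd x y x∈Λ₂ y∈Λ₂ with parity-B-factors G G-sym rank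
... | A , A-sym , f , factor = isotropy-defect-zero
  (trans (isotropy-defect-pullback (λ a b → parityℤ (B G a b)) (form A) f factor x₀ x y)
         (isotropy-defect-vanishes r≤2 A A-sym (f x₀) (f x) (f y)))
  Q-odd (2∣⇒parity≡0 x∈Λ₂) (2∣⇒parity≡0 y∈Λ₂)

sumℤ≡sum : ∀ {n} (f : Fin n → ℤ) → sumℤ f ≡ Overℤ.sum f
sumℤ≡sum {ℕ.zero}  f = refl
sumℤ≡sum {ℕ.suc n} f = cong (λ s → f zero ℤ.+ s) (sumℤ≡sum (f ∘ suc))

B≡form : ∀ {n} (G : Gram n) x y → B G x y ≡ Overℤ.form G x y
B≡form G x y = trans (sumℤ≡sum (λ i → sumℤ (λ j → x i ℤ.* G i j ℤ.* y j)))
                     (Overℤ.sum-cong-≋ (λ i → sumℤ≡sum (λ j → x i ℤ.* G i j ℤ.* y j)))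

lincomb≡ : ∀ {k n} (v : Fin k → Vecℤ n) c i → Defs.lincomb v c i ≡ Overℤ.lincomb v c i
lincomb≡ v c i = sumℤ≡sum (λ a → c a ℤ.* v a i)

Q-cong : ∀ {n} (G : Gram n) {x x'} → (∀ i → x i ≡ x' i) → Q G x ≡ Q G x'
Q-cong G {x} {x'} x≗x' =
  trans (B≡form G x x) (trans (Overℤ.form-cong (λ _ _ → refl) x≗x' x≗x') (sym (B≡form G x' x')))

∣-sum : ∀ {n} {d} (f : Vector ℤ n) → (∀ i → d ℤS.∣ f i) → d ℤS.∣ Overℤ.sum f
∣-sum {ℕ.zero}  f _   = ℤS.∣ᵤ⇒∣ (ℕD._∣0 _)
∣-sum {ℕ.suc n} f d∣f = ℤS.∣m∣n⇒∣m+n (d∣f zero) (∣-sum (f ∘ suc) (d∣f ∘ suc))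


-- When t b₀ = 1, the vectors v b + t b · v b₀ form a basis of { ∑ c_b v_b : c · t even }.
module Shear {n k} (v : Fin k → Vecℤ n) (t : Vector ℤ k) (b₀ : Fin k) where

  sheared : Fin k → Vecℤ n
  sheared b i = v b i ℤ.+ t b ℤ.* v b₀ i

  dot : Vector ℤ k → ℤ
  dot c = Overℤ.sum (λ b → c b ℤ.* t b)

  shift : Vector ℤ k → ℤ → Vector ℤ k
  shift c m b = c b ℤ.+ m ℤ.* Overℤ.1ᴹ b₀ b

  lincomb-sheared : ∀ d i → Overℤ.lincomb sheared d i ≡ Overℤ.lincomb v d i ℤ.+ dot d ℤ.* v b₀ i
  lincomb-sheared d i = begin
    Overℤ.sum (λ b → d b ℤ.* (v b i ℤ.+ t b ℤ.* v b₀ i))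
      ≡⟨ Overℤ.sum-cong-≋ (λ b → expand (d b) (v b i) (t b) (v b₀ i)) ⟩
    Overℤ.sum (λ b → d b ℤ.* v b i ℤ.+ d b ℤ.* t b ℤ.* v b₀ i)
      ≡⟨ Overℤ.∑-distrib-+ (λ b → d b ℤ.* v b i) (λ b → d b ℤ.* t b ℤ.* v b₀ i) ⟩
    Overℤ.lincomb v d i ℤ.+ Overℤ.sum (λ b → d b ℤ.* t b ℤ.* v b₀ i)
      ≡⟨ cong (λ s → Overℤ.lincomb v d i ℤ.+ s) (Overℤ.*-distribʳ-sum (v b₀ i) (λ b → d b ℤ.* t b)) ⟨
    Overℤ.lincomb v d i ℤ.+ dot d ℤ.* v b₀ i
      ∎
    where
    open ≡-Reasoning
    expand : ∀ d x s w → d ℤ.* (x ℤ.+ s ℤ.* w) ≡ d ℤ.* x ℤ.+ d ℤ.* s ℤ.* w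
    expand = solve-∀

  shift-self : ∀ c m → shift c m b₀ ≡ c b₀ ℤ.+ m
  shift-self c m = cong (λ s → c b₀ ℤ.+ s) (trans (cong (m ℤ.*_) (Overℤ.1ᴹ-diagonal b₀)) (ℤP.*-identityʳ m))

  shift-off : ∀ c m {b} → b ≢ b₀ → shift c m b ≡ c b
  shift-off c m {b} b≢b₀ = trans (cong (λ s → c b ℤ.+ m ℤ.* s) (Overℤ.1ᴹ-offDiagonal (b≢b₀ ∘ sym)))
                                 (trans (cong (λ s → c b ℤ.+ s) (ℤP.*-zeroʳ m)) (ℤP.+-identityʳ (c b)))

  lincomb-shift : ∀ c m i → Overℤ.lincomb v (shift c m) i ≡ Overℤ.lincomb v c i ℤ.+ m ℤ.* v b₀ i
  lincomb-shift c m i = Overℤ.∑-shift b₀ m c (λ b → v b i)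

  dot-shift : ∀ c m → dot (shift c m) ≡ dot c ℤ.+ m ℤ.* t b₀
  dot-shift c m = Overℤ.∑-shift b₀ m c t

  module _ (v-basis : IsBasis Whole k v) (t₀≡1 : t b₀ ≡ + 1) where

    sheared-independent : ∀ d → (∀ i → Defs.lincomb sheared d i ≡ + 0) → ∀ b → d b ≡ + 0
    sheared-independent d d↦0 = d≡0
      where
      shifted≡0 : ∀ b → shift d (dot d) b ≡ + 0
      shifted≡0 = proj₂ (proj₂ v-basis) (shift d (dot d)) (λ i → begin
        Defs.lincomb v (shift d (dot d)) i        ≡⟨ lincomb≡ v (shift d (dot d)) i ⟩
        Overℤ.lincomb v (shift d (dot d)) i       ≡⟨ lincomb-shift d (dot d) i ⟩
        Overℤ.lincomb v d i ℤ.+ dot d ℤ.* v b₀ i  ≡⟨ lincomb-sheared d i ⟨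
        Overℤ.lincomb sheared d i                 ≡⟨ lincomb≡ sheared d i ⟨
        Defs.lincomb sheared d i                  ≡⟨ d↦0 i ⟩
        + 0                                       ∎)
        where open ≡-Reasoning
      d-off : ∀ b → b ≢ b₀ → d b ≡ + 0
      d-off b b≢b₀ = trans (sym (shift-off d (dot d) b≢b₀)) (shifted≡0 b)
      dot≡d₀ : dot d ≡ d b₀
      dot≡d₀ = trans
        (Overℤ.sum-single (λ b → d b ℤ.* t b) b₀ (λ b b≢b₀ → trans (cong (ℤ._* t b) (d-off b b≢b₀)) (ℤP.*-zeroˡ (t b))))
        (trans (cong (d b₀ ℤ.*_) t₀≡1) (ℤP.*-identityʳ (d b₀)))
      d₀≡0 : d b₀ ≡ + 0
      d₀≡0 = ℤP.*-cancelˡ-≡ (+ 2) (d b₀) (+ 0) (begin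
        + 2 ℤ.* d b₀          ≡⟨ double (d b₀) ⟩
        d b₀ ℤ.+ d b₀         ≡⟨ cong (λ s → d b₀ ℤ.+ s) dot≡d₀ ⟨
        d b₀ ℤ.+ dot d        ≡⟨ shift-self d (dot d) ⟨
        shift d (dot d) b₀    ≡⟨ shifted≡0 b₀ ⟩
        + 0                   ∎)
        where
        open ≡-Reasoning
        double : ∀ x → + 2 ℤ.* x ≡ x ℤ.+ x
        double = solve-∀
      d≡0 : ∀ b → d b ≡ + 0
      d≡0 b with b ≟ᶠ b₀
      ... | yes refl = d₀≡0
      ... | no  b≢b₀ = d-off b b≢b₀

    sheared-spans : ∀ (x : Vecℤ n) c → (∀ i → x i ≡ Defs.lincomb v c i) → (+ 2) ℤD.∣ dot c →
                    ∃ λ d → ∀ i → x i ≡ Defs.lincomb sheared d i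
    sheared-spans x c x≗vc 2∣dot with ℤS.∣ᵤ⇒∣ {+ 2} {dot c} 2∣dot
    ... | ℤS.divides h dot≡h*2 = shift c (- h) , λ i → let L = Overℤ.lincomb v c i; w = v b₀ i in begin
      x i
        ≡⟨ x≗vc i ⟩
      Defs.lincomb v c i
        ≡⟨ lincomb≡ v c i ⟩
      L
        ≡⟨ cancel L h w ⟩
      (L ℤ.+ - h ℤ.* w) ℤ.+ (h ℤ.* + 2 ℤ.+ - h ℤ.* + 1) ℤ.* w
        ≡⟨ cong₂ (λ p q → (L ℤ.+ - h ℤ.* w) ℤ.+ (p ℤ.+ - h ℤ.* q) ℤ.* w) dot≡h*2 t₀≡1 ⟨
      (L ℤ.+ - h ℤ.* w) ℤ.+ (dot c ℤ.+ - h ℤ.* t b₀) ℤ.* w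
        ≡⟨ cong₂ (λ p q → p ℤ.+ q ℤ.* w) (lincomb-shift c (- h) i) (dot-shift c (- h)) ⟨
      Overℤ.lincomb v (shift c (- h)) i ℤ.+ dot (shift c (- h)) ℤ.* w
        ≡⟨ lincomb-sheared (shift c (- h)) i ⟨
      Overℤ.lincomb sheared (shift c (- h)) i
        ≡⟨ lincomb≡ sheared (shift c (- h)) i ⟨
      Defs.lincomb sheared (shift c (- h)) i
        ∎
      where
      open ≡-Reasoning
      cancel : ∀ L h w → L ≡ (L ℤ.+ - h ℤ.* w) ℤ.+ (h ℤ.* + 2 ℤ.+ - h ℤ.* + 1) ℤ.* w
      cancel = solve-∀

representative : Parity → ℤ
representative 0ℙ = + 0
representative 1ℙ = + 1

parityℤ-representative : ∀ p → parityℤ (representative p) ≡ p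
parityℤ-representative 0ℙ = refl
parityℤ-representative 1ℙ = refl

≢1ℙ⇒≡0ℙ : ∀ {p} → p ≢ 1ℙ → p ≡ 0ℙ
≢1ℙ⇒≡0ℙ {0ℙ} _   = refl
≢1ℙ⇒≡0ℙ {1ℙ} p≢1 = ⊥-elim (p≢1 refl)

-- Q(∑ c_b v_b) ≡ ∑ c_b Q(v_b) modulo 2, so Λ₂(L) is the kernel of c ↦ c · t modulo 2 for t_b = Q(v_b) mod 2.
module OddBasisVector {n k} (G : Gram n) (G-sym : Symmetric G) (v : Fin k → Vecℤ n) (v-basis : IsBasis Whole k v)
                      (b₀ : Fin k) (v₀-odd : parityℤ (Q G (v b₀)) ≡ 1ℙ) where

  ε : Fin k → Parity
  ε b = parityℤ (Q G (v b))

  open Shear v (representative ∘ ε) b₀ public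

  sheared∈Λ₂ : ∀ b → Λ₂ G (sheared b)
  sheared∈Λ₂ b = parity≡0⇒2∣ _ (begin
    parityℤ (Q G (sheared b))                       ≡⟨ cong parityℤ (Q-cong G as-pair) ⟩
    parityℤ (Q G (Defs.lincomb pair coefficients))  ≡⟨ parity-Q-lincomb G G-sym pair coefficients ⟩
    (1ℙ ℙ.* ε b) ℙ.+ ((parityℤ (representative (ε b)) ℙ.* ε b₀) ℙ.+ 0ℙ)
      ≡⟨ cong₂ (λ p q → (1ℙ ℙ.* ε b) ℙ.+ ((p ℙ.* q) ℙ.+ 0ℙ)) (parityℤ-representative (ε b)) v₀-odd ⟩
    (1ℙ ℙ.* ε b) ℙ.+ ((ε b ℙ.* 1ℙ) ℙ.+ 0ℙ)           ≡⟨ twice (ε b) ⟩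
    0ℙ                                              ∎)
    where
    open ≡-Reasoning
    pair : Fin 2 → Vecℤ n
    pair zero    = v b
    pair (suc _) = v b₀
    coefficients : Fin 2 → ℤ
    coefficients zero    = + 1
    coefficients (suc _) = representative (ε b)
    as-pair : ∀ i → sheared b i ≡ Defs.lincomb pair coefficients i
    as-pair i = expand (v b i) (representative (ε b)) (v b₀ i)
      where
      expand : ∀ x s w → x ℤ.+ s ℤ.* w ≡ + 1 ℤ.* x ℤ.+ (s ℤ.* w ℤ.+ + 0)
      expand = solve-∀
    twice : ∀ p → (1ℙ ℙ.* p) ℙ.+ ((p ℙ.* 1ℙ) ℙ.+ 0ℙ) ≡ 0ℙ
    twice 0ℙ = refl
    twice 1ℙ = refl

  Λ₂⊆span : ∀ x → Λ₂ G x → ∃ λ d → ∀ i → x i ≡ Defs.lincomb sheared d i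
  Λ₂⊆span x x∈Λ₂ with proj₁ (proj₂ v-basis) x tt
  ... | c , x≗vc = sheared-spans v-basis t₀≡1 x c x≗vc (parity≡0⇒2∣ _ (begin
    parityℤ (dot c)                               ≡⟨ cong parityℤ (sumℤ≡sum (λ b → c b ℤ.* t b)) ⟨
    parityℤ (sumℤ (λ b → c b ℤ.* t b))            ≡⟨ parityℤ-sumℤ (λ b → c b ℤ.* t b) ⟩
    ∑[ b < k ] parityℤ (c b ℤ.* t b)              ≡⟨ sum-cong-≋ (λ b → trans (parityℤ-* (c b) (t b))
                                                       (cong (parityℤ (c b) ℙ.*_) (parityℤ-representative (ε b)))) ⟩
    ∑[ b < k ] (parityℤ (c b) ℙ.* ε b)            ≡⟨ parity-Q-lincomb G G-sym v c ⟨
    parityℤ (Q G (Defs.lincomb v c))              ≡⟨ cong parityℤ (Q-cong G x≗vc) ⟨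
    parityℤ (Q G x)                               ≡⟨ 2∣⇒parity≡0 x∈Λ₂ ⟩
    0ℙ                                            ∎))
    where
    open ≡-Reasoning
    t = representative ∘ ε
    t₀≡1 : t b₀ ≡ + 1
    t₀≡1 = cong representative v₀-odd

  sheared-isBasis : IsBasis (Λ₂ G) k sheared
  sheared-isBasis = sheared∈Λ₂ , Λ₂⊆span , sheared-independent v-basis (cong representative v₀-odd)

  sheared-fixes-Λ₂ : ∀ a → Λ₂ G (v a) → ∀ i → sheared a i ≡ v a i
  sheared-fixes-Λ₂ a va∈Λ₂ i =
    trans (cong (λ p → v a i ℤ.+ representative p ℤ.* v b₀ i) (2∣⇒parity≡0 va∈Λ₂)) (ℤP.+-identityʳ (v a i))

Λ₂-basis : ∀ {n k} (G : Gram n) → Symmetric G → (v : Fin k → Vecℤ n) → IsBasis Whole k v →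
  Σ (Fin k → Vecℤ n) λ w → IsBasis (Λ₂ G) k w × (∀ a → Λ₂ G (v a) → ∀ i → w a i ≡ v a i)
Λ₂-basis G G-sym v v-basis with any? (λ b → parityℤ (Q G (v b)) ℙP.≟ 1ℙ)
... | yes (b₀ , v₀-odd) = sheared , sheared-isBasis , sheared-fixes-Λ₂
  where open OddBasisVector G G-sym v v-basis b₀ v₀-odd
... | no  no-odd = v , (v∈Λ₂ , (λ x _ → proj₁ (proj₂ v-basis) x tt) , proj₂ (proj₂ v-basis)) , (λ _ _ _ → refl)
  where
  v∈Λ₂ : ∀ a → Λ₂ G (v a)
  v∈Λ₂ a = parity≡0⇒2∣ _ (≢1ℙ⇒≡0ℙ (λ odd → no-odd (a , odd)))

gcdᵛ : ∀ {k} → Vector ℕ k → ℕ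
gcdᵛ = foldr ℕG.gcd 0

gcdᵛ-∣ : ∀ {k} (f : Vector ℕ k) a → gcdᵛ f ℕD.∣ f a
gcdᵛ-∣ f zero    = ℕG.gcd[m,n]∣m (f zero) (gcdᵛ (f ∘ suc))
gcdᵛ-∣ f (suc a) = ℕD.∣-trans (ℕG.gcd[m,n]∣n (f zero) (gcdᵛ (f ∘ suc))) (gcdᵛ-∣ (f ∘ suc) a)

∣-gcdᵛ : ∀ {k d} (f : Vector ℕ k) → (∀ a → d ℕD.∣ f a) → d ℕD.∣ gcdᵛ f
∣-gcdᵛ {ℕ.zero}  f _   = ℕD._∣0 _
∣-gcdᵛ {ℕ.suc k} f d∣f = ℕG.gcd-greatest (d∣f zero) (∣-gcdᵛ (f ∘ suc) (d∣f ∘ suc))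

module Scale {n k} (G : Gram n) {M : Vecℤ n → Set} {w : Fin k → Vecℤ n} (w-basis : IsBasis M k w) where

  scale : ℕ
  scale = gcdᵛ (λ a → gcdᵛ (λ b → ∣ B G (w a) (w b) ∣))

  scale-∣ : ∀ x y → M x → M y → (+ scale) ℤD.∣ B G x y
  scale-∣ x y x∈M y∈M with proj₁ (proj₂ w-basis) x x∈M | proj₁ (proj₂ w-basis) y y∈M
  ... | c , x≗wc | d , y≗wd = ℤS.∣⇒∣ᵤ (subst (+ scale ℤS.∣_) (sym B≡gram-form)
    (∣-sum _ (λ a → ∣-sum _ (λ b → ℤS.∣m⇒∣m*n (d b) (ℤS.∣n⇒∣m*n (c a) (scale-∣-gram a b))))))
    where
    open ≡-Reasoning
    B≡gram-form : B G x y ≡ Overℤ.form (Overℤ.gram G w) c d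
    B≡gram-form = begin
      B G x y
        ≡⟨ B≡form G x y ⟩
      Overℤ.form G x y
        ≡⟨ Overℤ.form-cong (λ _ _ → refl) (λ i → trans (x≗wc i) (lincomb≡ w c i))
                                          (λ i → trans (y≗wd i) (lincomb≡ w d i)) ⟩
      Overℤ.form G (Overℤ.lincomb w c) (Overℤ.lincomb w d)
        ≡⟨ Overℤ.form-lincomb G w c d ⟩
      Overℤ.form (Overℤ.gram G w) c d
        ∎
    scale-∣-gram : ∀ a b → + scale ℤS.∣ Overℤ.gram G w a b
    scale-∣-gram a b = subst (+ scale ℤS.∣_) (B≡form G (w a) (w b))
      (ℤS.∣ᵤ⇒∣ {+ scale} {B G (w a) (w b)} (ℕD.∣-trans (gcdᵛ-∣ _ a) (gcdᵛ-∣ (λ b → ∣ B G (w a) (w b) ∣) b)))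

  scale-greatest : ∀ d → (∀ x y → M x → M y → d ℤD.∣ B G x y) → d ℤD.∣ (+ scale)
  scale-greatest d d∣B = ∣-gcdᵛ _ (λ a → ∣-gcdᵛ _ (λ b → d∣B (w a) (w b) (proj₁ w-basis a) (proj₁ w-basis b)))

  scale-positive : ∀ x → M x → Q G x ≢ + 0 → 0 ℕ.< scale
  scale-positive x x∈M Qx≢0 = ℕP.n≢0⇒n>0 λ scale≡0 →
    Qx≢0 (ℤP.∣i∣≡0⇒i≡0 (ℕD.0∣⇒≡0 (subst (ℕD._∣ ∣ Q G x ∣) scale≡0 (scale-∣ x x x∈M x∈M))))

-- 2x is computed as the combination of the one-vector family x with coefficient 2.
Q-double : ∀ {n} (G : Gram n) x → Q G (λ i → + 2 ℤ.* x i) ≡ + 4 ℤ.* Q G x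
Q-double G x = begin
  Q G 2x                                              ≡⟨ B≡form G 2x 2x ⟩
  Overℤ.form G 2x 2x                                  ≡⟨ Overℤ.form-cong {x = 2x} {2x'} {2x} {2x'} (λ _ _ → refl) 2x≡ 2x≡ ⟩
  Overℤ.form G 2x' 2x'                                ≡⟨ Overℤ.form-lincomb {1} G (const x) (const (+ 2)) (const (+ 2)) ⟩
  (+ 2 ℤ.* Overℤ.form G x x ℤ.* + 2 ℤ.+ + 0) ℤ.+ + 0  ≡⟨ quadruple (Overℤ.form G x x) ⟩
  + 4 ℤ.* Overℤ.form G x x                            ≡⟨ cong (+ 4 ℤ.*_) (B≡form G x x) ⟨
  + 4 ℤ.* Q G x                                       ∎
  where
  open ≡-Reasoning
  2x 2x' : Vecℤ _
  2x i = + 2 ℤ.* x i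
  2x' = Overℤ.lincomb {1} (const x) (const (+ 2))
  2x≡ : ∀ i → 2x i ≡ 2x' i
  2x≡ i = sym (ℤP.+-identityʳ (2x i))
  quadruple : ∀ q → (+ 2 ℤ.* q ℤ.* + 2 ℤ.+ + 0) ℤ.+ + 0 ≡ + 4 ℤ.* q
  quadruple = solve-∀

primitive-in-Λ₂ : ∀ {n} (G : Gram n) → Symmetric G → ∀ {x} → PrimitiveIn Whole x → Λ₂ G x → PrimitiveIn (Λ₂ G) x
primitive-in-Λ₂ G G-sym (k , v , v-basis , a , va≗x) x∈Λ₂ with Λ₂-basis G G-sym v v-basis
... | w , w-basis , preserved = k , w , w-basis , a , λ i → trans (preserved a va∈Λ₂ i) (va≗x i)
  where
  va∈Λ₂ : Λ₂ G (v a)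
  va∈Λ₂ = subst ((+ 2) ℤD.∣_) (sym (Q-cong G va≗x)) x∈Λ₂

λ₂-represents : ∀ {n r} (G : Gram n) → Symmetric G → r ≤ 2 → UnimodularComponentRank G r →
  ∀ {m₀} → LPrimRep G m₀ → parity m₀ ≡ 1ℙ →
  Σ ℕ λ s → 0 ℕ.< s × (∀ m → LPrimRep G (s ℕ.* m) → λ₂PrimRep G m)
λ₂-represents G G-sym r≤2 rank (x₀ , (_ , v , v-basis , _) , Qx₀≡m₀) m₀-odd =
  scale , scale>0 , represent
  where
  Qx₀-odd : parityℤ (Q G x₀) ≡ 1ℙ
  Qx₀-odd = trans (cong parityℤ Qx₀≡m₀) m₀-odd
  open Scale G (proj₁ (proj₂ (Λ₂-basis G G-sym v v-basis)))

  scale>0 : 0 ℕ.< scale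
  scale>0 = scale-positive 2x₀ 2x₀∈Λ₂ Q2x₀≢0
    where
    2x₀ = λ i → + 2 ℤ.* x₀ i
    2x₀∈Λ₂ : Λ₂ G 2x₀
    2x₀∈Λ₂ = parity≡0⇒2∣ _ (trans (cong parityℤ (Q-double G x₀)) (parityℤ-* (+ 4) (Q G x₀)))
    Q2x₀≢0 : Q G 2x₀ ≢ + 0
    Q2x₀≢0 Q2x₀≡0
      with trans (sym Qx₀-odd) (cong parityℤ (ℤP.*-cancelˡ-≡ (+ 4) (Q G x₀) (+ 0) (trans (sym (Q-double G x₀)) Q2x₀≡0)))
    ... | ()

  2∣scale : 2 ℕD.∣ scale
  2∣scale = scale-greatest (+ 2) λ x y x∈Λ₂ y∈Λ₂ →
    parity≡0⇒2∣ _ (Λ₂-isotropic G G-sym r≤2 rank x₀ Qx₀-odd x y x∈Λ₂ y∈Λ₂)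

  represent : ∀ m → LPrimRep G (scale ℕ.* m) → λ₂PrimRep G m
  represent m (x , x-primitive , Qx≡sm) =
    scale , (scale>0 , scale-∣ , scale-greatest) , x , primitive-in-Λ₂ G G-sym x-primitive x∈Λ₂ , Qx≡sm
    where
    x∈Λ₂ : Λ₂ G x
    x∈Λ₂ = subst ((+ 2) ℤD.∣_) (sym Qx≡sm) (ℕD.∣m⇒∣m*n m 2∣scale)

scaled-universal : ∀ {R R' : ℕ → Set} {s} → 0 ℕ.< s → (∀ m → R (s ℕ.* m) → R' m) →
                   PrimUniversal R → PrimUniversal R'
scaled-universal {s = s} s>0 R⇒R' R-universal m 1≤m =
  R⇒R' m (R-universal (s ℕ.* m) (ℕP.≤-trans 1≤m (ℕP.m≤n*m m s {{ℕ.>-nonZero s>0}})))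

scaled-almost-universal : ∀ {R R' : ℕ → Set} {s} → 0 ℕ.< s → (∀ m → R (s ℕ.* m) → R' m) →
                          PrimAlmostUniversal R → PrimAlmostUniversal R'
scaled-almost-universal {s = s} s>0 R⇒R' (N , R-almost) =
  N , λ m N<m → R⇒R' m (R-almost (s ℕ.* m) (ℕP.<-≤-trans N<m (ℕP.m≤n*m m s {{ℕ.>-nonZero s>0}})))

lemma2p1 : (n : ℕ) (G : Gram n) → IsZLattice G →
    Σ ℕ (λ r → r ≤ 2 × UnimodularComponentRank G r) →
    (PrimAlmostUniversal (LPrimRep G) → PrimAlmostUniversal (λ₂PrimRep G)) ×
    (PrimUniversal (LPrimRep G) → PrimUniversal (λ₂PrimRep G))
lemma2p1 n G (G-sym , _) (r , r≤2 , rank) = almost-universal , universal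
  where
  almost-universal : PrimAlmostUniversal (LPrimRep G) → PrimAlmostUniversal (λ₂PrimRep G)
  almost-universal L-almost@(N , represents) =
    let odd-value = represents (ℕ.suc (2 ℕ.* N)) (s≤s (ℕP.m≤m+n N (1 ℕ.* N)))
        odd = trans (ℙP.+-homo-+ 1 (2 ℕ.* N)) (cong (1ℙ ℙ.+_) (ℙP.*-homo-* 2 N))
        (s , s>0 , transfer) = λ₂-represents G G-sym r≤2 rank odd-value odd
    in scaled-almost-universal s>0 transfer L-almost

  universal : PrimUniversal (LPrimRep G) → PrimUniversal (λ₂PrimRep G)
  universal L-universal =
    let (s , s>0 , transfer) = λ₂-represents G G-sym r≤2 rank (L-universal 1 (s≤s z≤n)) refl
    in scaled-universal s>0 transfer L-universal
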